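{- Let $p$ be an odd prime and $j\in\{1,4,8\}$ such that $8x^2+27y^2=jp$ has a solution $(x,y)\in\mathbb{Z}^2$ with $\gcd(x,y)=1$. Let $m$ be a positive integer with $p\nmid m$ and $pm\equiv 11\pmod{24}$. Define \[ U_{p,m}=\{(u,v)\in\mathbb{Z}^2: 8u^2+27v^2=pm,\ \gcd(u,v)=1\},\qquad A_m=\{(a,b)\in\mathbb{Z}^2: a^2+216b^2=jm,\ \gcd(a,b)=1\}. \] Then $|U_{p,m}|=2|A_m|$. -}

module Defs where

open import Data.Nat as ℕ using (ℕ)
open import Data.Integer using (ℤ; +_; _+_; _*_)
open import Data.Integer.GCD using (gcd)
open import Data.Product using (Σ; _×_; proj₁; proj₂)
open import Relation.Binary.PropositionalEquality using (_≡_)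

Coprimeℤ : ℤ → ℤ → Set
Coprimeℤ x y = gcd x y ≡ + 1

U : ℕ → ℕ → Set
U p m = Σ (ℤ × ℤ) λ uv →
  (+ 8 * (proj₁ uv * proj₁ uv) + + 27 * (proj₂ uv * proj₂ uv) ≡ + (p ℕ.* m))
  × Coprimeℤ (proj₁ uv) (proj₂ uv)

A : ℕ → ℕ → Set
A j m = Σ (ℤ × ℤ) λ ab →
  (proj₁ ab * proj₁ ab + + 216 * (proj₂ ab * proj₂ ab) ≡ + (j ℕ.* m))
  × Coprimeℤ (proj₁ ab) (proj₂ ab)

-- With j = 2ᵏ, the forms compose: 8(xa + 27yb)² + 27(ya − 8xb)² = (8x² + 27y²)(a² + 216b²) = j²·pm.
-- Since pm ≡ 3 (mod 4), a 2-adic descent shows that j divides xa + 27yb and ya − 8xb, so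
-- (a , b) ↦ ((xa + 27yb)/j , (ya − 8xb)/j) maps A_m into U_{p,m}. Its inverse
-- (u , v) ↦ ((8xu + 27yv)/p , (yu − xv)/p) is defined exactly on the (u , v) with p ∣ yu − xv, and
-- both maps preserve coprimality (a common divisor divides p, resp. j, and is then ruled out).
-- Finally p divides 8(yu − xv)(−yu − xv) = p(jv² − my²) but cannot divide both factors, so U_{p,m} is the
-- disjoint union of the images of A_m under the maps for (x , y) and for (x , −y).
module Submission where

open import Axiom.UniquenessOfIdentityProofs using (module Decidable⇒UIP)
open import Data.Empty using (⊥; ⊥-elim)
open import Data.Fin using (Fin; zero; suc; toℕ; fromℕ<)
open import Data.Fin.Properties using (+↔⊎; *↔×; toℕ-injective; toℕ-fromℕ<)
open import Data.Integer as ℤ using (ℤ; +_; -[1+_]; _+_; _-_; -_; _*_; _^_; ∣_∣; 1ℤ; NonZero)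
import Data.Integer.Coprimality as ℤ
open import Data.Integer.DivMod using (_%ℕ_; _/ℕ_; n%ℕd<d; a≡a%ℕn+[a/ℕn]*n)
open import Data.Integer.Divisibility.Signed
open import Data.Integer.Properties
  using (_≟_; +-injective; -[1+-injective; abs-*; pos-+; pos-*; ∣-i∣≡∣i∣; neg-involutive;
         +-comm; +-identityˡ; *-comm; *-identityˡ; *-identityʳ; *-cancelˡ-≡; *-cancelʳ-≡)
open import Data.Integer.Tactic.RingSolver using (solve)
open import Data.List using (_∷_; [])
open import Data.Nat as ℕ using (ℕ; zero; suc)
import Data.Nat.Coprimality as ℕ
import Data.Nat.Divisibility as ℕ
import Data.Nat.DivMod as ℕ
import Data.Nat.GCD as ℕ
import Data.Nat.Properties as ℕ
open import Data.Nat.Primality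
  using (Prime; prime?; euclidsLemma; prime⇒irreducible; prime⇒nonZero; ¬prime[1]; prime[2])
open import Data.Product using (Σ; ∃; ∃₂; _×_; _,_; proj₁; proj₂)
open import Data.Product.Function.NonDependent.Propositional using (_×-↔_)
open import Data.Sum using (_⊎_; inj₁; inj₂; [_,_]′; reduce)
open import Data.Sum.Function.Propositional using (_⊎-↔_)
open import Function using (id; _∘_; case_of_)
open import Function.Bundles using (_↔_; mk↔ₛ′; Inverse)
open import Function.Properties.Inverse using (↔-refl; ↔-trans; ↔-sym)
open import Relation.Nullary using (¬_; Dec; yes; no; Irrelevant)
open import Relation.Nullary.Decidable using (dec-yes-irr; dec-no; _×-dec_; from-yes; from-no)
open import Relation.Binary.PropositionalEquality hiding (J)
open ≡-Reasoning

open import Defs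

linear-combination : ∀ {a b x y : ℤ} (c : ℤ) → a ≡ b → x - y ≡ c * (a - b) → x ≡ y
linear-combination {a} {_} {x} {y} c refl x-y≡c[a-a] = begin
  x                ≡⟨ solve (x ∷ y ∷ []) ⟩
  (x - y) + y      ≡⟨ cong (_+ y) x-y≡c[a-a] ⟩
  c * (a - a) + y  ≡⟨ solve (a ∷ c ∷ y ∷ []) ⟩
  y                ∎

pos-^ : ∀ n k → + (n ℕ.^ k) ≡ (+ n) ^ k
pos-^ n zero = refl
pos-^ n (suc k) = trans (pos-* n (n ℕ.^ k)) (cong (+ n *_) (pos-^ n k))

≡-irrelevantℤ : {a b : ℤ} → Irrelevant (a ≡ b)
≡-irrelevantℤ = Decidable⇒UIP.≡-irrelevant _≟_

≡×≡-irrelevant : {a b c d : ℤ} → Irrelevant ((a ≡ b) × (c ≡ d))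
≡×≡-irrelevant (e , f) (e′ , f′) = cong₂ _,_ (≡-irrelevantℤ e e′) (≡-irrelevantℤ f f′)

∣-irrelevant : ∀ {k z} .{{_ : NonZero k}} → Irrelevant (k ∣ z)
∣-irrelevant {k} (divides q eq) (divides q′ eq′) with *-cancelʳ-≡ q q′ k (trans (sym eq) eq′)
... | refl = cong (divides q) (≡-irrelevantℤ eq eq′)

Σ-≡-irrelevant : ∀ {X : Set} {P : X → Set} → (∀ x → Irrelevant (P x)) →
                 {s t : Σ X P} → proj₁ s ≡ proj₁ t → s ≡ t
Σ-≡-irrelevant irr {x , p} {.x , q} refl = cong (x ,_) (irr x p q)

-- Finite types

Finite : Set → Set
Finite A = ∃ λ n → Fin n ↔ A

finite-↔ : ∀ {A B} → Finite A → A ↔ B → Finite B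
finite-↔ (n , f) g = n , ↔-trans f g

finite-prop : ∀ {A} → Dec A → Irrelevant A → Finite A
finite-prop (yes a) irr = 1 , mk↔ₛ′ (λ _ → a) (λ _ → zero) (irr a) λ { zero → refl ; (suc ()) }
finite-prop (no ¬a) _ = 0 , mk↔ₛ′ (λ ()) (⊥-elim ∘ ¬a) (⊥-elim ∘ ¬a) (λ ())

finite-⊎ : ∀ {A B} → Finite A → Finite B → Finite (A ⊎ B)
finite-⊎ (m , f) (n , g) = m ℕ.+ n , ↔-trans +↔⊎ (f ⊎-↔ g)

finite-× : ∀ {A B} → Finite A → Finite B → Finite (A × B)
finite-× (m , f) (n , g) = m ℕ.* n , ↔-trans *↔× (f ×-↔ g)

Σ-Fin-suc↔ : ∀ {N} (Q : Fin (suc N) → Set) → Σ (Fin (suc N)) Q ↔ (Q zero ⊎ Σ (Fin N) (Q ∘ suc))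
Σ-Fin-suc↔ Q = mk↔ₛ′ to from to∘from from∘to
  where
  to : Σ _ Q → Q zero ⊎ Σ _ (Q ∘ suc)
  to (zero , q) = inj₁ q
  to (suc i , q) = inj₂ (i , q)
  from : Q zero ⊎ Σ _ (Q ∘ suc) → Σ _ Q
  from (inj₁ q) = zero , q
  from (inj₂ (i , q)) = suc i , q
  to∘from : ∀ s → to (from s) ≡ s
  to∘from (inj₁ _) = refl
  to∘from (inj₂ _) = refl
  from∘to : ∀ s → from (to s) ≡ s
  from∘to (zero , _) = refl
  from∘to (suc _ , _) = refl

finite-Σ-Fin : ∀ N (Q : Fin N → Set) → (∀ i → Dec (Q i)) → (∀ i → Irrelevant (Q i)) → Finite (Σ (Fin N) Q)
finite-Σ-Fin zero Q _ _ = 0 , mk↔ₛ′ (λ ()) (λ ()) (λ ()) (λ ())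
finite-Σ-Fin (suc N) Q Q? irr = finite-↔
  (finite-⊎ (finite-prop (Q? zero) (irr zero)) (finite-Σ-Fin N (Q ∘ suc) (Q? ∘ suc) (irr ∘ suc)))
  (↔-sym (Σ-Fin-suc↔ Q))

finite-Σ-image : ∀ {D X : Set} {P : X → Set} → Finite D →
  (f : D → X) → (∀ {d d′} → f d ≡ f d′ → d ≡ d′) →
  (∀ x → Dec (P x)) → (∀ x → Irrelevant (P x)) →
  (∀ x → P x → ∃ λ d → f d ≡ x) → Finite (Σ X P)
finite-Σ-image {P = P} (N , e) f f-inj P? irr image =
  finite-↔ (finite-Σ-Fin N (P ∘ g) (P? ∘ g) (irr ∘ g)) (mk↔ₛ′ to from to∘from from∘to)
  where
  open Inverse e using (strictlyInverseˡ; strictlyInverseʳ) renaming (to to enum; from to index)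
  g = f ∘ enum
  g-index : ∀ d → g (index d) ≡ f d
  g-index d = cong f (strictlyInverseˡ d)
  to : Σ _ (P ∘ g) → Σ _ P
  to (i , q) = g i , q
  from : Σ _ P → Σ _ (P ∘ g)
  from (x , q) = let d , fd≡x = image x q in
    index d , subst P (sym (trans (g-index d) fd≡x)) q
  to∘from : ∀ s → to (from s) ≡ s
  to∘from (x , q) = Σ-≡-irrelevant irr (trans (g-index _) (proj₂ (image x q)))
  from∘to : ∀ s → from (to s) ≡ s
  from∘to (i , q) = Σ-≡-irrelevant (irr ∘ g)
    (trans (cong index (f-inj (proj₂ (image (g i) q)))) (strictlyInverseʳ i))

ℤ-interval : ∀ K → Fin (suc K) ⊎ Fin K → ℤ
ℤ-interval K (inj₁ i) = + toℕ i
ℤ-interval K (inj₂ i) = -[1+ toℕ i ]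

ℤ-interval-injective : ∀ {K i i′} → ℤ-interval K i ≡ ℤ-interval K i′ → i ≡ i′
ℤ-interval-injective {i = inj₁ _} {inj₁ _} eq = cong inj₁ (toℕ-injective (+-injective eq))
ℤ-interval-injective {i = inj₂ _} {inj₂ _} eq = cong inj₂ (toℕ-injective (-[1+-injective eq))

ℤ-interval-surjective : ∀ {K} a → ∣ a ∣ ℕ.≤ K → ∃ λ i → ℤ-interval K i ≡ a
ℤ-interval-surjective (+ n) n≤K = inj₁ (fromℕ< (ℕ.s≤s n≤K)) , cong +_ (toℕ-fromℕ< (ℕ.s≤s n≤K))
ℤ-interval-surjective -[1+ n ] n<K = inj₂ (fromℕ< n<K) , cong -[1+_] (toℕ-fromℕ< n<K)

finite-bounded-pairs : ∀ K (P : ℤ × ℤ → Set) → (∀ ab → Dec (P ab)) → (∀ ab → Irrelevant (P ab)) →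
  (∀ a b → P (a , b) → ∣ a ∣ ℕ.≤ K × ∣ b ∣ ℕ.≤ K) → Finite (Σ (ℤ × ℤ) P)
finite-bounded-pairs K P P? irr bound =
  finite-Σ-image (finite-× interval-finite interval-finite) box box-injective P? irr box-surjective
  where
  interval-finite : Finite (Fin (suc K) ⊎ Fin K)
  interval-finite = finite-⊎ (_ , ↔-refl) (_ , ↔-refl)
  box : (Fin (suc K) ⊎ Fin K) × (Fin (suc K) ⊎ Fin K) → ℤ × ℤ
  box (i , j) = ℤ-interval K i , ℤ-interval K j
  box-injective : ∀ {d d′} → box d ≡ box d′ → d ≡ d′
  box-injective eq = cong₂ _,_ (ℤ-interval-injective (cong proj₁ eq)) (ℤ-interval-injective (cong proj₂ eq))
  box-surjective : ∀ ab → P ab → ∃ λ d → box d ≡ ab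
  box-surjective (a , b) Pab =
    let i , eq₁ = ℤ-interval-surjective a (proj₁ (bound a b Pab))
        j , eq₂ = ℤ-interval-surjective b (proj₂ (bound a b Pab))
    in (i , j) , cong₂ _,_ eq₁ eq₂

↔-from-correspondence : ∀ {A B : Set} (R : A → B → Set) →
  (∀ a → Σ B (R a)) → (∀ b → Σ A λ a → R a b) →
  (∀ {a b b′} → R a b → R a b′ → b ≡ b′) → (∀ {a a′ b} → R a b → R a′ b → a ≡ a′) → A ↔ B
↔-from-correspondence R image preimage functional injective = mk↔ₛ′ to from to∘from from∘to
  where
  to = proj₁ ∘ image
  from = proj₁ ∘ preimage
  to∘from : ∀ b → to (from b) ≡ b
  to∘from b = functional (proj₂ (image (from b))) (proj₂ (preimage b))
  from∘to : ∀ a → from (to a) ≡ a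
  from∘to a = injective (proj₂ (preimage (to a))) (proj₂ (image a))

-- Divisibility, primes and coprimality

Coprimeℤ⇒Coprime : ∀ {a b} → Coprimeℤ a b → ℤ.Coprime a b
Coprimeℤ⇒Coprime = ℕ.gcd≡1⇒coprime ∘ +-injective

Coprimeℤ-intro : ∀ {a b} → (∀ {d} → + d ∣ a → + d ∣ b → d ≡ 1) → Coprimeℤ a b
Coprimeℤ-intro {a} {b} h =
  cong +_ (ℕ.coprime⇒gcd≡1 {∣ a ∣} {∣ b ∣} λ (d∣a , d∣b) → h (∣ᵤ⇒∣ d∣a) (∣ᵤ⇒∣ d∣b))

coprime⇒common-divisor≡1 : ∀ {a b d} → Coprimeℤ a b → + d ∣ a → + d ∣ b → d ≡ 1
coprime⇒common-divisor≡1 {a} {b} c d∣a d∣b = Coprimeℤ⇒Coprime {a} {b} c (∣⇒∣ᵤ d∣a , ∣⇒∣ᵤ d∣b)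

coprime⇒∣-multiplier : ∀ {a b c d} → Coprimeℤ a b → + d ∣ a * c → + d ∣ b * c → d ℕ.∣ ∣ c ∣
coprime⇒∣-multiplier {a} {b} {c} {d} cop d∣ac d∣bc = ℕ.coprime-factors (Coprimeℤ⇒Coprime {a} {b} cop)
  ( subst (d ℕ.∣_) (abs-* a c) (∣⇒∣ᵤ {+ d} {a * c} d∣ac)
  , subst (d ℕ.∣_) (abs-* b c) (∣⇒∣ᵤ {+ d} {b * c} d∣bc))

module _ {p} (p-prime : Prime p) where

  prime-∣-* : ∀ {a b} → + p ∣ a * b → (+ p ∣ a) ⊎ (+ p ∣ b)
  prime-∣-* {a} {b} p∣ab
    with euclidsLemma ∣ a ∣ ∣ b ∣ p-prime (subst (p ℕ.∣_) (abs-* a b) (∣⇒∣ᵤ {+ p} {a * b} p∣ab))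
  ... | inj₁ p∣a = inj₁ (∣ᵤ⇒∣ p∣a)
  ... | inj₂ p∣b = inj₂ (∣ᵤ⇒∣ p∣b)

  prime-∣-square : ∀ {z} → + p ∣ z * z → + p ∣ z
  prime-∣-square = reduce ∘ prime-∣-*

  prime-∣-cancel : ∀ {c z} → ¬ p ℕ.∣ c → + p ∣ + c * z → + p ∣ z
  prime-∣-cancel {c} p∤c = [ (λ p∣c → ⊥-elim (p∤c (∣⇒∣ᵤ {+ p} {+ c} p∣c))) , id ]′ ∘ prime-∣-*

  prime-∣-^ : ∀ {c} n → p ℕ.∣ c ℕ.^ n → p ℕ.∣ c
  prime-∣-^ zero p∣1 = ⊥-elim (¬prime[1] (subst Prime (ℕ.∣1⇒≡1 p∣1) p-prime))
  prime-∣-^ {c} (suc n) p∣cⁿ⁺¹ = [ id , prime-∣-^ n ]′ (euclidsLemma c (c ℕ.^ n) p-prime p∣cⁿ⁺¹)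

  prime∤⇒coprime : ∀ {n} → ¬ p ℕ.∣ n → ℕ.Coprime p n
  prime∤⇒coprime p∤n (d∣p , d∣n) with prime⇒irreducible p-prime d∣p
  ... | inj₁ d≡1 = d≡1
  ... | inj₂ refl = ⊥-elim (p∤n d∣n)

prime∣prime⇒≡ : ∀ {p q} → Prime p → Prime q → p ℕ.∣ q → p ≡ q
prime∣prime⇒≡ prime-p prime-q p∣q with prime⇒irreducible prime-q p∣q
... | inj₁ refl = ⊥-elim (¬prime[1] prime-p)
... | inj₂ p≡q = p≡q

divisor-of-2^k : ∀ k {d} → d ℕ.∣ 2 ℕ.^ k → d ≡ 1 ⊎ (2 ℕ.∣ d)
divisor-of-2^k zero d∣1 = inj₁ (ℕ.∣1⇒≡1 d∣1)
divisor-of-2^k (suc k) {d} d∣2^k+1 with 2 ℕ.∣? d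
... | yes 2∣d = inj₂ 2∣d
... | no 2∤d = divisor-of-2^k k (ℕ.coprime-divisor (ℕ.sym (prime∤⇒coprime prime[2] 2∤d)) d∣2^k+1)

-- Parity and powers of two

¬2∣4k+3 : ∀ k → ¬ + 2 ∣ + 4 * k + + 3
¬2∣4k+3 k (divides q eq) = from-no (2 ℕ.∣? 1)
  (∣⇒∣ᵤ {+ 2} {1ℤ} (divides (q - + 2 * k - 1ℤ) (linear-combination 1ℤ eq (solve (k ∷ q ∷ [])))))

4k+1≢4l+3 : ∀ k l → + 4 * k + 1ℤ ≢ + 4 * l + + 3
4k+1≢4l+3 k l eq = from-no (4 ℕ.∣? 2)
  (∣⇒∣ᵤ {+ 4} {+ 2} (divides (k - l) (linear-combination (- 1ℤ) eq (solve (k ∷ l ∷ [])))))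

even-or-odd : ∀ z → + 2 ∣ z ⊎ ∃ λ k → z ≡ + 2 * k + 1ℤ
even-or-odd z with z %ℕ 2 | n%ℕd<d z 2 | z /ℕ 2 | a≡a%ℕn+[a/ℕn]*n z 2
... | 0           | _                  | q | eq = inj₁ (divides q (trans eq (+-identityˡ (q * + 2))))
... | 1           | _                  | q | eq =
  inj₂ (q , trans eq (trans (+-comm 1ℤ (q * + 2)) (cong (_+ 1ℤ) (*-comm q (+ 2)))))
... | suc (suc _) | ℕ.s≤s (ℕ.s≤s ()) | _ | _

2∣27v²⇒2∣v : ∀ {v} → + 2 ∣ + 27 * (v * v) → + 2 ∣ v
2∣27v²⇒2∣v = prime-∣-square prime[2] ∘ prime-∣-cancel prime[2] (from-no (2 ℕ.∣? 27))

2∣8x²+27y²⇒2∣y : ∀ {x y} → + 2 ∣ + 8 * (x * x) + + 27 * (y * y) → + 2 ∣ y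
2∣8x²+27y²⇒2∣y {x} 2∣form = 2∣27v²⇒2∣v (∣m+n∣m⇒∣n 2∣form (∣m⇒∣m*n (x * x) (divides (+ 4) refl)))

2∣y⇒2∣8x²+27y² : ∀ {x y} → + 2 ∣ y → + 2 ∣ + 8 * (x * x) + + 27 * (y * y)
2∣y⇒2∣8x²+27y² {x} {y} 2∣y =
  ∣m∣n⇒∣m+n (∣m⇒∣m*n (x * x) (divides (+ 4) refl)) (∣n⇒∣m*n (+ 27) (∣m⇒∣m*n y 2∣y))

-- For odd u, 2u² + 27v² is even when v is even, and ≡ 2 + 27 ≡ 1 (mod 4) when v is odd (odd squares are 1 mod 4).
2u²+27v²≡4t+3⇒2∣u : ∀ {u v t} → + 2 * (u * u) + + 27 * (v * v) ≡ + 4 * t + + 3 → + 2 ∣ u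
2u²+27v²≡4t+3⇒2∣u {u} {v} {t} eq with even-or-odd u | even-or-odd v
... | inj₁ 2∣u        | _                     = 2∣u
... | inj₂ (a , refl) | inj₁ (divides b refl) = ⊥-elim (odd-even a b eq)
  where
  odd-even : ∀ a b → + 2 * ((+ 2 * a + 1ℤ) * (+ 2 * a + 1ℤ)) + + 27 * ((b * + 2) * (b * + 2)) ≢ + 4 * t + + 3
  odd-even a b eq = ¬2∣4k+3 t
    (divides ((+ 2 * a + 1ℤ) * (+ 2 * a + 1ℤ) + + 54 * (b * b)) (linear-combination (- 1ℤ) eq (solve (a ∷ b ∷ t ∷ []))))
... | inj₂ (a , refl) | inj₂ (b , refl)       = ⊥-elim (odd-odd a b eq)
  where
  odd-odd : ∀ a b → + 2 * ((+ 2 * a + 1ℤ) * (+ 2 * a + 1ℤ)) + + 27 * ((+ 2 * b + 1ℤ) * (+ 2 * b + 1ℤ)) ≢ + 4 * t + + 3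
  odd-odd a b eq = 4k+1≢4l+3 (+ 2 * (a * a + a) + + 27 * (b * b + b) + + 7) t
    (linear-combination 1ℤ eq (solve (a ∷ b ∷ t ∷ [])))

-- The divisibility witnesses are taken apart by local functions rather than by `with`, whose abstraction
-- would make Agda normalise these computable proofs (at a prohibitive cost).
2u²+27v²-descent : ∀ {u v r} → + 2 * (u * u) + + 27 * (v * v) ≡ + 4 * r →
  ∃₂ λ u′ v′ → u ≡ u′ * + 2 × v ≡ v′ * + 2 × + 2 * (u′ * u′) + + 27 * (v′ * v′) ≡ r
2u²+27v²-descent {u} {v} {r} eq =
  halve-v (2∣27v²⇒2∣v (divides (+ 2 * r - u * u) (linear-combination 1ℤ eq (solve (u ∷ v ∷ r ∷ [])))))
  where
  Halves : Set
  Halves = ∃₂ λ u′ v′ → u ≡ u′ * + 2 × v ≡ v′ * + 2 × + 2 * (u′ * u′) + + 27 * (v′ * v′) ≡ r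
  halve-v : + 2 ∣ v → Halves
  halve-v (divides v′ v≡) = halve-u (prime-∣-square prime[2] (divides (r - + 27 * (v′ * v′))
      (*-cancelˡ-≡ (+ 2) _ _ (linear-combination 1ℤ eq′ (solve (u ∷ v′ ∷ r ∷ []))))))
    where
    eq′ : + 2 * (u * u) + + 27 * ((v′ * + 2) * (v′ * + 2)) ≡ + 4 * r
    eq′ = subst (λ w → + 2 * (u * u) + + 27 * (w * w) ≡ + 4 * r) v≡ eq
    halve-u : + 2 ∣ u → Halves
    halve-u (divides u′ u≡) =
      u′ , v′ , u≡ , v≡ , *-cancelˡ-≡ (+ 4) _ _ (linear-combination 1ℤ eq″ (solve (u′ ∷ v′ ∷ r ∷ [])))
      where
      eq″ : + 2 * ((u′ * + 2) * (u′ * + 2)) + + 27 * ((v′ * + 2) * (v′ * + 2)) ≡ + 4 * r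
      eq″ = subst (λ w → + 2 * (w * w) + + 27 * ((v′ * + 2) * (v′ * + 2)) ≡ + 4 * r) u≡ eq′

8u²+27v²-descent : ∀ {u v r} → + 8 * (u * u) + + 27 * (v * v) ≡ + 4 * r →
  ∃ λ v′ → v ≡ v′ * + 2 × + 2 * (u * u) + + 27 * (v′ * v′) ≡ r
8u²+27v²-descent {u} {v} {r} eq =
  halve-v (2∣27v²⇒2∣v (divides (+ 2 * r - + 4 * (u * u)) (linear-combination 1ℤ eq (solve (u ∷ v ∷ r ∷ [])))))
  where
  halve-v : + 2 ∣ v → ∃ λ v′ → v ≡ v′ * + 2 × + 2 * (u * u) + + 27 * (v′ * v′) ≡ r
  halve-v (divides v′ v≡) =
    v′ , v≡ , *-cancelˡ-≡ (+ 4) _ _ (linear-combination 1ℤ eq′ (solve (u ∷ v′ ∷ r ∷ [])))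
    where
    eq′ : + 8 * (u * u) + + 27 * ((v′ * + 2) * (v′ * + 2)) ≡ + 4 * r
    eq′ = subst (λ w → + 8 * (u * u) + + 27 * (w * w) ≡ + 4 * r) v≡ eq

1∣ : ∀ z → 1ℤ ∣ z
1∣ z = divides z (sym (*-identityʳ z))

∣-double : ∀ {d z} → d ∣ z → + 2 * d ∣ z * + 2
∣-double {d} (divides q refl) = divides q (solve (d ∷ q ∷ []))

≡[2e]²t⇒≡4e²t : ∀ {z} e t → z ≡ (+ 2 * e) * (+ 2 * e) * t → z ≡ + 4 * (e * e * t)
≡[2e]²t⇒≡4e²t {z} e t eq = linear-combination 1ℤ eq (solve (z ∷ e ∷ t ∷ []))

2-adic-2u²+27v² : ∀ k {u v t} → + 2 * (u * u) + + 27 * (v * v) ≡ (+ 2) ^ k * (+ 2) ^ k * (+ 4 * t + + 3) →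
  ((+ 2) ^ suc k ∣ u) × ((+ 2) ^ k ∣ v)
2-adic-2u²+27v² zero {u} {v} {t} eq = 2u²+27v²≡4t+3⇒2∣u {u} {v} {t} (trans eq (*-identityˡ _)) , 1∣ v
2-adic-2u²+27v² (suc k) {u} {v} {t} eq =
  lift (2u²+27v²-descent {u} {v} (≡[2e]²t⇒≡4e²t ((+ 2) ^ k) (+ 4 * t + + 3) eq))
  where
  lift : ∃₂ (λ u′ v′ → u ≡ u′ * + 2 × v ≡ v′ * + 2 ×
                       + 2 * (u′ * u′) + + 27 * (v′ * v′) ≡ (+ 2) ^ k * (+ 2) ^ k * (+ 4 * t + + 3)) →
         ((+ 2) ^ suc (suc k) ∣ u) × ((+ 2) ^ suc k ∣ v)
  lift (u′ , v′ , u≡ , v≡ , reduced) = let 2ᵏ⁺¹∣u′ , 2ᵏ∣v′ = 2-adic-2u²+27v² k {u′} {v′} {t} reduced in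
    subst (_ ∣_) (sym u≡) (∣-double 2ᵏ⁺¹∣u′) , subst (_ ∣_) (sym v≡) (∣-double 2ᵏ∣v′)

2-adic-8u²+27v² : ∀ k {u v t} → + 8 * (u * u) + + 27 * (v * v) ≡ (+ 2) ^ k * (+ 2) ^ k * (+ 4 * t + + 3) →
  ((+ 2) ^ k ∣ u) × ((+ 2) ^ k ∣ v)
2-adic-8u²+27v² zero {u} {v} eq = 1∣ u , 1∣ v
2-adic-8u²+27v² (suc k) {u} {v} {t} eq =
  lift (8u²+27v²-descent {u} {v} (≡[2e]²t⇒≡4e²t ((+ 2) ^ k) (+ 4 * t + + 3) eq))
  where
  lift : ∃ (λ v′ → v ≡ v′ * + 2 × + 2 * (u * u) + + 27 * (v′ * v′) ≡ (+ 2) ^ k * (+ 2) ^ k * (+ 4 * t + + 3)) →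
         ((+ 2) ^ suc k ∣ u) × ((+ 2) ^ suc k ∣ v)
  lift (v′ , v≡ , reduced) = let 2ᵏ⁺¹∣u , 2ᵏ∣v′ = 2-adic-2u²+27v² k {u} {v′} {t} reduced in
    2ᵏ⁺¹∣u , subst (_ ∣_) (sym v≡) (∣-double 2ᵏ∣v′)

-- The forms 8u² + 27v² and a² + 216b²

module Composition (x y J P : ℤ) .{{_ : NonZero J}} .{{_ : NonZero P}}
  (rep : + 8 * (x * x) + + 27 * (y * y) ≡ J * P) where

  -- (u , v) = M (a , b) / J for M = [[x , 27y] , [y , −8x]]. With N = [[8x , 27y] , [y , −x]] one has
  -- N M = M N = (8x² + 27y²) I = J P I, which gives the dual description (a , b) = N (u , v) / P.
  data _↦_ : ℤ × ℤ → ℤ × ℤ → Set where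
    ↦-intro : ∀ {a b u v} → x * a + + 27 * y * b ≡ u * J → y * a - + 8 * x * b ≡ v * J → (a , b) ↦ (u , v)

  norm-multiplicative : ∀ {a b N} → a * a + + 216 * (b * b) ≡ J * N →
    + 8 * ((x * a + + 27 * y * b) * (x * a + + 27 * y * b)) + + 27 * ((y * a - + 8 * x * b) * (y * a - + 8 * x * b))
    ≡ J * J * (P * N)
  norm-multiplicative {a} {b} {N} eq = begin
    + 8 * ((x * a + + 27 * y * b) * (x * a + + 27 * y * b)) + + 27 * ((y * a - + 8 * x * b) * (y * a - + 8 * x * b))
      ≡⟨ solve (x ∷ y ∷ a ∷ b ∷ []) ⟩
    (+ 8 * (x * x) + + 27 * (y * y)) * (a * a + + 216 * (b * b)) ≡⟨ cong₂ _*_ rep eq ⟩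
    J * P * (J * N)                                              ≡⟨ solve (J ∷ P ∷ N ∷ []) ⟩
    J * J * (P * N)                                              ∎

  ↦-dual : ∀ {a b u v} → (a , b) ↦ (u , v) → (+ 8 * x * u + + 27 * y * v ≡ a * P) × (y * u - x * v ≡ b * P)
  ↦-dual {a} {b} {u} {v} (↦-intro eq₁ eq₂) = *-cancelˡ-≡ J _ _ first , *-cancelˡ-≡ J _ _ second
    where
    first : J * (+ 8 * x * u + + 27 * y * v) ≡ J * (a * P)
    first = begin
      J * (+ 8 * x * u + + 27 * y * v)        ≡⟨ solve (x ∷ y ∷ J ∷ u ∷ v ∷ []) ⟩
      + 8 * x * (u * J) + + 27 * y * (v * J)  ≡⟨ cong₂ (λ s t → + 8 * x * s + + 27 * y * t) eq₁ eq₂ ⟨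
      + 8 * x * (x * a + + 27 * y * b) + + 27 * y * (y * a - + 8 * x * b) ≡⟨ solve (x ∷ y ∷ a ∷ b ∷ []) ⟩
      (+ 8 * (x * x) + + 27 * (y * y)) * a    ≡⟨ cong (_* a) rep ⟩
      J * P * a                               ≡⟨ solve (J ∷ P ∷ a ∷ []) ⟩
      J * (a * P)                             ∎
    second : J * (y * u - x * v) ≡ J * (b * P)
    second = begin
      J * (y * u - x * v)                     ≡⟨ solve (x ∷ y ∷ J ∷ u ∷ v ∷ []) ⟩
      y * (u * J) - x * (v * J)               ≡⟨ cong₂ (λ s t → y * s - x * t) eq₁ eq₂ ⟨
      y * (x * a + + 27 * y * b) - x * (y * a - + 8 * x * b) ≡⟨ solve (x ∷ y ∷ a ∷ b ∷ []) ⟩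
      (+ 8 * (x * x) + + 27 * (y * y)) * b    ≡⟨ cong (_* b) rep ⟩
      J * P * b                               ≡⟨ solve (J ∷ P ∷ b ∷ []) ⟩
      J * (b * P)                             ∎

  dual-↦ : ∀ {a b u v} → + 8 * x * u + + 27 * y * v ≡ a * P → y * u - x * v ≡ b * P → (a , b) ↦ (u , v)
  dual-↦ {a} {b} {u} {v} eq₁ eq₂ = ↦-intro (*-cancelˡ-≡ P _ _ first) (*-cancelˡ-≡ P _ _ second)
    where
    first : P * (x * a + + 27 * y * b) ≡ P * (u * J)
    first = begin
      P * (x * a + + 27 * y * b)              ≡⟨ solve (x ∷ y ∷ P ∷ a ∷ b ∷ []) ⟩
      x * (a * P) + + 27 * y * (b * P)        ≡⟨ cong₂ (λ s t → x * s + + 27 * y * t) eq₁ eq₂ ⟨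
      x * (+ 8 * x * u + + 27 * y * v) + + 27 * y * (y * u - x * v) ≡⟨ solve (x ∷ y ∷ u ∷ v ∷ []) ⟩
      (+ 8 * (x * x) + + 27 * (y * y)) * u    ≡⟨ cong (_* u) rep ⟩
      J * P * u                               ≡⟨ solve (J ∷ P ∷ u ∷ []) ⟩
      P * (u * J)                             ∎
    second : P * (y * a - + 8 * x * b) ≡ P * (v * J)
    second = begin
      P * (y * a - + 8 * x * b)               ≡⟨ solve (x ∷ y ∷ P ∷ a ∷ b ∷ []) ⟩
      y * (a * P) - + 8 * x * (b * P)         ≡⟨ cong₂ (λ s t → y * s - + 8 * x * t) eq₁ eq₂ ⟨
      y * (+ 8 * x * u + + 27 * y * v) - + 8 * x * (y * u - x * v) ≡⟨ solve (x ∷ y ∷ u ∷ v ∷ []) ⟩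
      (+ 8 * (x * x) + + 27 * (y * y)) * v    ≡⟨ cong (_* v) rep ⟩
      J * P * v                               ≡⟨ solve (J ∷ P ∷ v ∷ []) ⟩
      P * (v * J)                             ∎

  ↦-norm : ∀ {a b u v} → (a , b) ↦ (u , v) →
    J * (+ 8 * (u * u) + + 27 * (v * v)) ≡ P * (a * a + + 216 * (b * b))
  ↦-norm {a} {b} {u} {v} (↦-intro eq₁ eq₂) = *-cancelˡ-≡ J _ _ (begin
    J * (J * (+ 8 * (u * u) + + 27 * (v * v)))  ≡⟨ solve (J ∷ u ∷ v ∷ []) ⟩
    + 8 * ((u * J) * (u * J)) + + 27 * ((v * J) * (v * J))
      ≡⟨ cong₂ (λ s t → + 8 * (s * s) + + 27 * (t * t)) eq₁ eq₂ ⟨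
    + 8 * ((x * a + + 27 * y * b) * (x * a + + 27 * y * b)) + + 27 * ((y * a - + 8 * x * b) * (y * a - + 8 * x * b))
      ≡⟨ solve (x ∷ y ∷ a ∷ b ∷ []) ⟩
    (+ 8 * (x * x) + + 27 * (y * y)) * (a * a + + 216 * (b * b)) ≡⟨ cong (_* (a * a + + 216 * (b * b))) rep ⟩
    J * P * (a * a + + 216 * (b * b))           ≡⟨ solve (J ∷ P ∷ a ∷ b ∷ []) ⟩
    J * (P * (a * a + + 216 * (b * b)))         ∎)

  ↦-norm⇒ : ∀ {a b u v N} → (a , b) ↦ (u , v) → a * a + + 216 * (b * b) ≡ J * N →
    + 8 * (u * u) + + 27 * (v * v) ≡ P * N
  ↦-norm⇒ {a} {b} {u} {v} {N} ab↦uv eq = *-cancelˡ-≡ J _ _ (begin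
    J * (+ 8 * (u * u) + + 27 * (v * v)) ≡⟨ ↦-norm ab↦uv ⟩
    P * (a * a + + 216 * (b * b))       ≡⟨ cong (P *_) eq ⟩
    P * (J * N)                         ≡⟨ solve (J ∷ P ∷ N ∷ []) ⟩
    J * (P * N)                         ∎)

  ↦-norm⇐ : ∀ {a b u v N} → (a , b) ↦ (u , v) → + 8 * (u * u) + + 27 * (v * v) ≡ P * N →
    a * a + + 216 * (b * b) ≡ J * N
  ↦-norm⇐ {a} {b} {u} {v} {N} ab↦uv eq = *-cancelˡ-≡ P _ _ (begin
    P * (a * a + + 216 * (b * b))       ≡⟨ ↦-norm ab↦uv ⟨
    J * (+ 8 * (u * u) + + 27 * (v * v)) ≡⟨ cong (J *_) eq ⟩
    J * (P * N)                         ≡⟨ solve (J ∷ P ∷ N ∷ []) ⟩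
    P * (J * N)                         ∎)

  ↦-functional : ∀ {a b u v u′ v′} → (a , b) ↦ (u , v) → (a , b) ↦ (u′ , v′) → (u , v) ≡ (u′ , v′)
  ↦-functional (↦-intro eq₁ eq₂) (↦-intro eq₁′ eq₂′) =
    cong₂ _,_ (*-cancelʳ-≡ _ _ J (trans (sym eq₁) eq₁′)) (*-cancelʳ-≡ _ _ J (trans (sym eq₂) eq₂′))

  ↦-injective : ∀ {a b a′ b′ u v} → (a , b) ↦ (u , v) → (a′ , b′) ↦ (u , v) → (a , b) ≡ (a′ , b′)
  ↦-injective ab↦uv a′b′↦uv =
    let eq₁ , eq₂ = ↦-dual ab↦uv
        eq₁′ , eq₂′ = ↦-dual a′b′↦uv
    in cong₂ _,_ (*-cancelʳ-≡ _ _ P (trans (sym eq₁) eq₁′)) (*-cancelʳ-≡ _ _ P (trans (sym eq₂) eq₂′))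

  ↦-common-divisor : ∀ {a b u v d} → (a , b) ↦ (u , v) → d ∣ a → d ∣ b → (d ∣ u * J) × (d ∣ v * J)
  ↦-common-divisor (↦-intro eq₁ eq₂) d∣a d∣b =
    subst (_ ∣_) eq₁ (∣m∣n⇒∣m+n (∣n⇒∣m*n x d∣a) (∣n⇒∣m*n (+ 27 * y) d∣b)) ,
    subst (_ ∣_) eq₂ (∣m∣n⇒∣m-n (∣n⇒∣m*n y d∣a) (∣n⇒∣m*n (+ 8 * x) d∣b))

  ↦-common-divisor⁻¹ : ∀ {a b u v d} → (a , b) ↦ (u , v) → d ∣ u → d ∣ v → (d ∣ a * P) × (d ∣ b * P)
  ↦-common-divisor⁻¹ ab↦uv d∣u d∣v = let eq₁ , eq₂ = ↦-dual ab↦uv in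
    subst (_ ∣_) eq₁ (∣m∣n⇒∣m+n (∣n⇒∣m*n (+ 8 * x) d∣u) (∣n⇒∣m*n (+ 27 * y) d∣v)) ,
    subst (_ ∣_) eq₂ (∣m∣n⇒∣m-n (∣n⇒∣m*n y d∣u) (∣n⇒∣m*n x d∣v))

  P∣v*[8xu+27yv] : ∀ {u v b N} → + 8 * (u * u) + + 27 * (v * v) ≡ P * N → y * u - x * v ≡ b * P →
    P ∣ v * (+ 8 * x * u + + 27 * y * v)
  P∣v*[8xu+27yv] {u} {v} {b} {N} eq₁ eq₂ = divides (y * N - + 8 * u * b) (begin
    v * (+ 8 * x * u + + 27 * y * v)                                ≡⟨ solve (x ∷ y ∷ u ∷ v ∷ []) ⟩
    y * (+ 8 * (u * u) + + 27 * (v * v)) - + 8 * u * (y * u - x * v) ≡⟨ cong₂ (λ s t → y * s - + 8 * u * t) eq₁ eq₂ ⟩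
    y * (P * N) - + 8 * u * (b * P)                                 ≡⟨ solve (y ∷ u ∷ b ∷ P ∷ N ∷ []) ⟩
    (y * N - + 8 * u * b) * P                                       ∎)

  conjugate-product : ∀ {u v N} → + 8 * (u * u) + + 27 * (v * v) ≡ P * N →
    + 8 * ((y * u - x * v) * (- y * u - x * v)) ≡ (J * (v * v) - N * (y * y)) * P
  conjugate-product {u} {v} {N} eq = begin
    + 8 * ((y * u - x * v) * (- y * u - x * v))  ≡⟨ solve (x ∷ y ∷ u ∷ v ∷ []) ⟩
    (+ 8 * (x * x) + + 27 * (y * y)) * (v * v) - (+ 8 * (u * u) + + 27 * (v * v)) * (y * y)
      ≡⟨ cong₂ (λ s t → s * (v * v) - t * (y * y)) rep eq ⟩
    J * P * (v * v) - P * N * (y * y)            ≡⟨ solve (y ∷ v ∷ J ∷ P ∷ N ∷ []) ⟩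
    (J * (v * v) - N * (y * y)) * P              ∎

  conjugate-difference : ∀ u v → (y * u - x * v) - (- y * u - x * v) ≡ + 2 * (y * u)
  conjugate-difference u v = solve (x ∷ y ∷ u ∷ v ∷ [])

∣both⇒∣cofactor : ∀ {P u v N} .{{_ : NonZero P}} →
  + 8 * (u * u) + + 27 * (v * v) ≡ P * N → P ∣ u → P ∣ v → P ∣ N
∣both⇒∣cofactor {P} {N = N} eq (divides u′ refl) (divides v′ refl) =
  divides (+ 8 * (u′ * u′) + + 27 * (v′ * v′)) (*-cancelˡ-≡ P _ _ (begin
    P * N                                                      ≡⟨ eq ⟨
    + 8 * ((u′ * P) * (u′ * P)) + + 27 * ((v′ * P) * (v′ * P)) ≡⟨ solve (P ∷ u′ ∷ v′ ∷ []) ⟩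
    P * ((+ 8 * (u′ * u′) + + 27 * (v′ * v′)) * P)             ∎))

module _ {p} (p-prime : Prime p) (p∤2 : ¬ p ℕ.∣ 2) (p∤3 : ¬ p ℕ.∣ 3) where

  ∣8x²+27y²⇒∤x×∤y : ∀ {x y} → Coprimeℤ x y → + p ∣ + 8 * (x * x) + + 27 * (y * y) →
    ¬ (+ p ∣ x) × ¬ (+ p ∣ y)
  ∣8x²+27y²⇒∤x×∤y {x} {y} coprime p∣form = p∤x , p∤y
    where
    ¬both : + p ∣ x → + p ∣ y → ⊥
    ¬both p∣x p∣y = ¬prime[1] (subst Prime (coprime⇒common-divisor≡1 coprime p∣x p∣y) p-prime)
    p∤x : ¬ + p ∣ x
    p∤x p∣x = ¬both p∣x (prime-∣-square p-prime (prime-∣-cancel p-prime (p∤3 ∘ prime-∣-^ p-prime 3)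
      (∣m+n∣m⇒∣n p∣form (∣n⇒∣m*n (+ 8) (∣m⇒∣m*n x p∣x)))))
    p∤y : ¬ + p ∣ y
    p∤y p∣y = ¬both (prime-∣-square p-prime (prime-∣-cancel p-prime (p∤2 ∘ prime-∣-^ p-prime 3)
      (∣m+n∣n⇒∣m p∣form (∣n⇒∣m*n (+ 27) (∣m⇒∣m*n y p∣y))))) p∣y

-- Counting

U⟨_,_⟩ : ℤ → ℤ → ℕ → ℕ → Set
U⟨ x , y ⟩ p m = Σ (U p m) λ w → + p ∣ y * proj₁ (proj₁ w) - x * proj₂ (proj₁ w)

module Representation {p m : ℕ} (k : ℕ) (p-prime : Prime p) (p∤2 : ¬ p ℕ.∣ 2) (p∤3 : ¬ p ℕ.∣ 3)
  (p∤m : ¬ p ℕ.∣ m) {t : ℤ} (pm≡4t+3 : + (p ℕ.* m) ≡ + 4 * t + + 3)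
  {x y : ℤ} (rep : + 8 * (x * x) + + 27 * (y * y) ≡ + (2 ℕ.^ k ℕ.* p)) (coprime-xy : Coprimeℤ x y) where

  instance
    _ = prime⇒nonZero p-prime
    _ = subst NonZero (pos-^ 2 k) (ℕ.m^n≢0 2 k)

  J : ℤ
  J = (+ 2) ^ k

  2^k*≡J* : ∀ n → + (2 ℕ.^ k ℕ.* n) ≡ J * + n
  2^k*≡J* n = trans (pos-* (2 ℕ.^ k) n) (cong (_* + n) (pos-^ 2 k))

  open Composition x y J (+ p) (trans rep (2^k*≡J* p))

  p∣8u²+27v² : ∀ {u v} → + 8 * (u * u) + + 27 * (v * v) ≡ + (p ℕ.* m) → + p ∣ + 8 * (u * u) + + 27 * (v * v)
  p∣8u²+27v² eq = divides (+ m) (trans eq (trans (pos-* p m) (*-comm (+ p) (+ m))))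

  ¬2∣b : ∀ {a b u v} → 2 ℕ.∣ 2 ℕ.^ k → (a , b) ↦ (u , v) →
    + 8 * (u * u) + + 27 * (v * v) ≡ + (p ℕ.* m) → ¬ + 2 ∣ b
  ¬2∣b {a} {b} {u} {v} 2∣2^k ab↦uv norm-uv 2∣b = [ ¬2∣x , ¬2∣v ]′ (prime-∣-* prime[2] 2∣xv)
    where
    2∣y : + 2 ∣ y
    2∣y = 2∣8x²+27y²⇒2∣y {x} (subst (+ 2 ∣_) (sym (trans rep (2^k*≡J* p)))
            (∣m⇒∣m*n (+ p) (∣ᵤ⇒∣ {+ 2} {J} (subst (2 ℕ.∣_) (cong ∣_∣ (pos-^ 2 k)) 2∣2^k))))
    ¬2∣x : ¬ + 2 ∣ x
    ¬2∣x 2∣x = case coprime⇒common-divisor≡1 coprime-xy 2∣x 2∣y of λ ()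
    ¬2∣v : ¬ + 2 ∣ v
    ¬2∣v 2∣v = ¬2∣4k+3 t (subst (+ 2 ∣_) (trans norm-uv pm≡4t+3) (2∣y⇒2∣8x²+27y² {u} 2∣v))
    2∣xv : + 2 ∣ x * v
    2∣xv = subst (+ 2 ∣_) (neg-involutive (x * v)) (∣m⇒∣-m (∣m+n∣m⇒∣n
      (subst (+ 2 ∣_) (sym (proj₂ (↦-dual ab↦uv))) (∣m⇒∣m*n (+ p) 2∣b)) (∣m⇒∣m*n u 2∣y)))

  coprime-image : ∀ {a b u v} → (a , b) ↦ (u , v) → Coprimeℤ a b →
    + 8 * (u * u) + + 27 * (v * v) ≡ + (p ℕ.* m) → Coprimeℤ u v
  coprime-image {a} {b} ab↦uv coprime-ab norm-uv = Coprimeℤ-intro λ d∣u d∣v →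
    let d∣aP , d∣bP = ↦-common-divisor⁻¹ ab↦uv d∣u d∣v in
    case prime⇒irreducible p-prime (coprime⇒∣-multiplier {a} {b} coprime-ab d∣aP d∣bP) of λ where
      (inj₁ d≡1) → d≡1
      (inj₂ refl) → ⊥-elim (p∤m (∣⇒∣ᵤ (∣both⇒∣cofactor (trans norm-uv (pos-* p m)) d∣u d∣v)))

  coprime-preimage : ∀ {a b u v} → (a , b) ↦ (u , v) → Coprimeℤ u v →
    + 8 * (u * u) + + 27 * (v * v) ≡ + (p ℕ.* m) → Coprimeℤ a b
  coprime-preimage {a} {b} {u} {v} ab↦uv coprime-uv norm-uv = Coprimeℤ-intro λ {d} d∣a d∣b →
    let d∣uJ , d∣vJ = ↦-common-divisor ab↦uv d∣a d∣b
        d∣2^k = subst (d ℕ.∣_) (cong ∣_∣ (sym (pos-^ 2 k))) (coprime⇒∣-multiplier {u} {v} coprime-uv d∣uJ d∣vJ)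
    in case divisor-of-2^k k d∣2^k of λ where
      (inj₁ d≡1) → d≡1
      (inj₂ 2∣d) → ⊥-elim (¬2∣b (ℕ.∣-trans 2∣d d∣2^k) ab↦uv norm-uv (∣-trans (∣ᵤ⇒∣ 2∣d) d∣b))

  image : (s : A (2 ℕ.^ k) m) → Σ (U⟨ x , y ⟩ p m) λ w → proj₁ s ↦ proj₁ (proj₁ w)
  image ((a , b) , norm-ab , coprime-ab) =
    lift (2-adic-8u²+27v² k {x * a + + 27 * y * b} {y * a - + 8 * x * b} {t}
           (trans (norm-multiplicative norm-ab′) (cong (J * J *_) (trans (sym (pos-* p m)) pm≡4t+3))))
    where
    norm-ab′ : a * a + + 216 * (b * b) ≡ J * + m
    norm-ab′ = trans norm-ab (2^k*≡J* m)
    lift : (J ∣ x * a + + 27 * y * b) × (J ∣ y * a - + 8 * x * b) →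
           Σ (U⟨ x , y ⟩ p m) λ w → (a , b) ↦ proj₁ (proj₁ w)
    lift (divides u eq₁ , divides v eq₂) = (((u , v) , norm-uv , coprime-image ab↦uv coprime-ab norm-uv) , p∣) , ab↦uv
      where
      ab↦uv = ↦-intro eq₁ eq₂
      norm-uv : + 8 * (u * u) + + 27 * (v * v) ≡ + (p ℕ.* m)
      norm-uv = trans (↦-norm⇒ ab↦uv norm-ab′) (sym (pos-* p m))
      p∣ : + p ∣ y * u - x * v
      p∣ = divides b (proj₂ (↦-dual ab↦uv))

  preimage : (w : U⟨ x , y ⟩ p m) → Σ (A (2 ℕ.^ k) m) λ s → proj₁ s ↦ proj₁ (proj₁ w)
  preimage (((u , v) , norm-uv , coprime-uv) , divides b eq₂) =
    lift ([ ⊥-elim ∘ p∤v , id ]′ (prime-∣-* p-prime {v} (P∣v*[8xu+27yv] {u} {v} {b} (trans norm-uv (pos-* p m)) eq₂)))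
    where
    p∤v = proj₂ (∣8x²+27y²⇒∤x×∤y p-prime p∤2 p∤3 {u} {v} coprime-uv (p∣8u²+27v² {u} {v} norm-uv))
    lift : + p ∣ + 8 * x * u + + 27 * y * v → Σ (A (2 ℕ.^ k) m) λ s → proj₁ s ↦ (u , v)
    lift (divides a eq₁) = ((a , b) , norm-ab , coprime-preimage ab↦uv coprime-uv norm-uv) , ab↦uv
      where
      ab↦uv = dual-↦ eq₁ eq₂
      norm-ab : a * a + + 216 * (b * b) ≡ + (2 ℕ.^ k ℕ.* m)
      norm-ab = trans (↦-norm⇐ ab↦uv (trans norm-uv (pos-* p m))) (sym (2^k*≡J* m))

  A↔U⟨x,y⟩ : A (2 ℕ.^ k) m ↔ U⟨ x , y ⟩ p m
  A↔U⟨x,y⟩ = ↔-from-correspondence (λ s w → proj₁ s ↦ proj₁ (proj₁ w)) image preimage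
    (λ r r′ → Σ-≡-irrelevant (λ _ → ∣-irrelevant) (Σ-≡-irrelevant (λ _ → ≡×≡-irrelevant) (↦-functional r r′)))
    (λ r r′ → Σ-≡-irrelevant (λ _ → ≡×≡-irrelevant) (↦-injective r r′))

  U⟨x,y⟩-disjoint : ∀ {u v} → + 8 * (u * u) + + 27 * (v * v) ≡ + (p ℕ.* m) → Coprimeℤ u v →
    + p ∣ y * u - x * v → + p ∣ - y * u - x * v → ⊥
  U⟨x,y⟩-disjoint {u} {v} norm-uv coprime-uv p∣₁ p∣₂ = [ p∤y , p∤u ]′ (prime-∣-* p-prime {y} {u}
    (prime-∣-cancel p-prime p∤2 (subst (+ p ∣_) (conjugate-difference u v) (∣m∣n⇒∣m-n p∣₁ p∣₂))))
    where
    p∤y = proj₂ (∣8x²+27y²⇒∤x×∤y p-prime p∤2 p∤3 {x} {y} coprime-xy (divides J (trans rep (2^k*≡J* p))))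
    p∤u = proj₁ (∣8x²+27y²⇒∤x×∤y p-prime p∤2 p∤3 {u} {v} coprime-uv (p∣8u²+27v² {u} {v} norm-uv))

  U⟨x,y⟩-cover : ∀ {u v} → + 8 * (u * u) + + 27 * (v * v) ≡ + (p ℕ.* m) →
    ¬ (+ p ∣ y * u - x * v) → + p ∣ - y * u - x * v
  U⟨x,y⟩-cover {u} {v} norm-uv p∤₁ = [ ⊥-elim ∘ p∤₁ , id ]′ (prime-∣-* p-prime
    (prime-∣-cancel p-prime (p∤2 ∘ prime-∣-^ p-prime 3)
      (divides (J * (v * v) - + m * (y * y)) (conjugate-product {u} {v} (trans norm-uv (pos-* p m))))))

  U↔U⟨x,y⟩⊎U⟨x,-y⟩ : U p m ↔ (U⟨ x , y ⟩ p m ⊎ U⟨ x , - y ⟩ p m)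
  U↔U⟨x,y⟩⊎U⟨x,-y⟩ = mk↔ₛ′ to from to∘from from∘to
    where
    sort : (w : U p m) → Dec (+ p ∣ y * proj₁ (proj₁ w) - x * proj₂ (proj₁ w)) →
           U⟨ x , y ⟩ p m ⊎ U⟨ x , - y ⟩ p m
    sort w (yes p∣) = inj₁ (w , p∣)
    sort w (no p∤) = inj₂ (w , U⟨x,y⟩-cover (proj₁ (proj₂ w)) p∤)
    to : U p m → U⟨ x , y ⟩ p m ⊎ U⟨ x , - y ⟩ p m
    to w = sort w (+ p ∣? _)
    from : U⟨ x , y ⟩ p m ⊎ U⟨ x , - y ⟩ p m → U p m
    from = [ proj₁ , proj₁ ]′
    to∘from : ∀ s → to (from s) ≡ s
    to∘from (inj₁ (w , p∣)) = cong (sort w) (dec-yes-irr (+ p ∣? _) ∣-irrelevant p∣)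
    to∘from (inj₂ (w@(_ , norm , coprime) , p∣)) = begin
      sort w (+ p ∣? _) ≡⟨ cong (sort w) (dec-no (+ p ∣? _) (λ p∣′ → U⟨x,y⟩-disjoint norm coprime p∣′ p∣)) ⟩
      inj₂ (w , _)      ≡⟨ cong (λ e → inj₂ (w , e)) (∣-irrelevant _ p∣) ⟩
      inj₂ (w , p∣)     ∎
    from-sort : ∀ w p∣? → from (sort w p∣?) ≡ w
    from-sort w (yes _) = refl
    from-sort w (no _) = refl
    from∘to : ∀ w → from (to w) ≡ w
    from∘to w = from-sort w (+ p ∣? _)

i*i≡+∣i∣*∣i∣ : ∀ i → i * i ≡ + (∣ i ∣ ℕ.* ∣ i ∣)
i*i≡+∣i∣*∣i∣ (+ n) = sym (pos-* n n)
i*i≡+∣i∣*∣i∣ -[1+ n ] = refl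

n≤n*n : ∀ n → n ℕ.≤ n ℕ.* n
n≤n*n zero = ℕ.z≤n
n≤n*n (suc n) = ℕ.m≤m*n (suc n) (suc n)

a²+216b²-bounds : ∀ {a b K} → a * a + + 216 * (b * b) ≡ + K → ∣ a ∣ ℕ.≤ K × ∣ b ∣ ℕ.≤ K
a²+216b²-bounds {a} {b} {K} eq =
  ℕ.≤-trans (n≤n*n ∣ a ∣) (subst (a² ℕ.≤_) K≡ (ℕ.m≤m+n a² (216 ℕ.* b²))) ,
  ℕ.≤-trans (n≤n*n ∣ b ∣)
    (ℕ.≤-trans (ℕ.m≤n*m b² 216) (subst (216 ℕ.* b² ℕ.≤_) K≡ (ℕ.m≤n+m (216 ℕ.* b²) a²)))
  where
  a² = ∣ a ∣ ℕ.* ∣ a ∣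
  b² = ∣ b ∣ ℕ.* ∣ b ∣
  K≡ : a² ℕ.+ 216 ℕ.* b² ≡ K
  K≡ = +-injective (begin
    + (a² ℕ.+ 216 ℕ.* b²)     ≡⟨ pos-+ a² (216 ℕ.* b²) ⟩
    + a² + + (216 ℕ.* b²)
      ≡⟨ cong₂ _+_ (i*i≡+∣i∣*∣i∣ a) (trans (cong (+ 216 *_) (i*i≡+∣i∣*∣i∣ b)) (sym (pos-* 216 b²))) ⟨
    a * a + + 216 * (b * b)   ≡⟨ eq ⟩
    + K                       ∎)

A-finite : ∀ j m → Finite (A j m)
A-finite j m = finite-bounded-pairs (j ℕ.* m) _ (λ _ → (_ ≟ _) ×-dec (_ ≟ _)) (λ _ → ≡×≡-irrelevant)
  (λ a b (norm , _) → a²+216b²-bounds {a} {b} norm)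

Fin[2n]↔Fin[n]⊎Fin[n] : ∀ n → Fin (2 ℕ.* n) ↔ (Fin n ⊎ Fin n)
Fin[2n]↔Fin[n]⊎Fin[n] n = subst (λ r → Fin (2 ℕ.* n) ↔ (Fin n ⊎ Fin r)) (ℕ.+-identityʳ n) +↔⊎

|U|≡2|A| : ∀ {p m x y t} k → Prime p → ¬ p ℕ.∣ 2 → ¬ p ℕ.∣ 3 → ¬ p ℕ.∣ m → + (p ℕ.* m) ≡ + 4 * t + + 3 →
  + 8 * (x * x) + + 27 * (y * y) ≡ + (2 ℕ.^ k ℕ.* p) → Coprimeℤ x y →
  ∃ λ n → (Fin (2 ℕ.* n) ↔ U p m) × (Fin n ↔ A (2 ℕ.^ k) m)
|U|≡2|A| {p} {m} {x} {y} {t} k p-prime p∤2 p∤3 p∤m pm≡4t+3 rep coprime-xy =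
  let n , Fin↔A = A-finite (2 ℕ.^ k) m in
  n , ↔-trans (Fin[2n]↔Fin[n]⊎Fin[n] n)
        (↔-trans (↔-trans Fin↔A R₊.A↔U⟨x,y⟩ ⊎-↔ ↔-trans Fin↔A R₋.A↔U⟨x,y⟩)
                 (↔-sym R₊.U↔U⟨x,y⟩⊎U⟨x,-y⟩)) ,
      Fin↔A
  where
  -y*-y≡y*y : - y * - y ≡ y * y
  -y*-y≡y*y = solve (y ∷ [])
  rep⁻ : + 8 * (x * x) + + 27 * (- y * - y) ≡ + (2 ℕ.^ k ℕ.* p)
  rep⁻ = trans (cong (λ s → + 8 * (x * x) + + 27 * s) -y*-y≡y*y) rep
  coprime-x-y : Coprimeℤ x (- y)
  coprime-x-y = trans (cong (λ n → + ℕ.gcd ∣ x ∣ n) (∣-i∣≡∣i∣ y)) coprime-xy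
  module R₊ = Representation k p-prime p∤2 p∤3 p∤m {t} pm≡4t+3 {x} {y} rep coprime-xy
  module R₋ = Representation k p-prime p∤2 p∤3 p∤m {t} pm≡4t+3 {x} { - y} rep⁻ coprime-x-y


odd-prime∤2 : ∀ {p} → Prime p → p ℕ.% 2 ≡ 1 → ¬ p ℕ.∣ 2
odd-prime∤2 p-prime p-odd p∣2 with prime∣prime⇒≡ p-prime prime[2] p∣2
odd-prime∤2 p-prime () p∣2 | refl

3m%24≢11 : ∀ m → (3 ℕ.* m) ℕ.% 24 ≢ 11
3m%24≢11 m eq with trans (sym (cong (ℕ._% 3) eq))
  (trans (ℕ.m∣n⇒o%n%m≡o%m 3 24 (3 ℕ.* m) (ℕ.divides 8 refl))
         (trans (cong (ℕ._% 3) (ℕ.*-comm 3 m)) (ℕ.m*n%n≡0 m 3)))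
... | ()

pm%24≡11⇒p∤3 : ∀ {p m} → Prime p → (p ℕ.* m) ℕ.% 24 ≡ 11 → ¬ p ℕ.∣ 3
pm%24≡11⇒p∤3 {m = m} p-prime pm%24≡11 p∣3 with prime∣prime⇒≡ p-prime (from-yes (prime? 3)) p∣3
... | refl = 3m%24≢11 m pm%24≡11

n%24≡11⇒n≡4q+3 : ∀ n → n ℕ.% 24 ≡ 11 → + n ≡ + 4 * + (n ℕ./ 4) + + 3
n%24≡11⇒n≡4q+3 n n%24≡11 = begin
  + n                             ≡⟨ cong +_ (ℕ.m≡m%n+[m/n]*n n 4) ⟩
  + (n ℕ.% 4 ℕ.+ n ℕ./ 4 ℕ.* 4)  ≡⟨ cong (λ r → + (r ℕ.+ n ℕ./ 4 ℕ.* 4)) n%4≡3 ⟩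
  + (3 ℕ.+ n ℕ./ 4 ℕ.* 4)         ≡⟨ trans (pos-+ 3 _) (cong (λ s → + 3 + s) (pos-* (n ℕ./ 4) 4)) ⟩
  + 3 + + (n ℕ./ 4) * + 4         ≡⟨ reorder (+ (n ℕ./ 4)) ⟩
  + 4 * + (n ℕ./ 4) + + 3         ∎
  where
  n%4≡3 : n ℕ.% 4 ≡ 3
  n%4≡3 = trans (sym (ℕ.m∣n⇒o%n%m≡o%m 4 24 n (ℕ.divides 6 refl))) (cong (ℕ._% 4) n%24≡11)
  reorder : ∀ q → + 3 + q * + 4 ≡ + 4 * q + + 3
  reorder q = solve (q ∷ [])

j≡1∨4∨8⇒j≡2ᵏ : ∀ {j} → j ≡ 1 ⊎ j ≡ 4 ⊎ j ≡ 8 → ∃ λ k → 2 ℕ.^ k ≡ j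
j≡1∨4∨8⇒j≡2ᵏ (inj₁ refl) = 0 , refl
j≡1∨4∨8⇒j≡2ᵏ (inj₂ (inj₁ refl)) = 2 , refl
j≡1∨4∨8⇒j≡2ᵏ (inj₂ (inj₂ refl)) = 3 , refl

lemma2p5 : (p j m : ℕ) → Prime p → p ℕ.% 2 ≡ 1
    → (j ≡ 1 ⊎ j ≡ 4 ⊎ j ≡ 8)
    → (Σ ℤ λ x → Σ ℤ λ y → (+ 8 ℤ.* (x ℤ.* x) ℤ.+ + 27 ℤ.* (y ℤ.* y) ≡ + (j ℕ.* p)) × Coprimeℤ x y)
    → m ≢ 0 → ¬ (p ℕ.∣ m) → (p ℕ.* m) ℕ.% 24 ≡ 11
    → ∃ λ n → (Fin (2 ℕ.* n) ↔ U p m) × (Fin n ↔ A j m)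
lemma2p5 p j m p-prime p-odd j∈1,4,8 (x , y , rep , coprime-xy) _ p∤m pm%24≡11 with j≡1∨4∨8⇒j≡2ᵏ j∈1,4,8
... | k , refl = |U|≡2|A| {x = x} {y} {+ (p ℕ.* m ℕ./ 4)} k p-prime (odd-prime∤2 p-prime p-odd)
                   (pm%24≡11⇒p∤3 p-prime pm%24≡11) p∤m (n%24≡11⇒n≡4q+3 (p ℕ.* m) pm%24≡11) rep coprime-xy
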